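{- The family $(\to_{S\langle R\rangle}, \to_{I\langle R\rangle})_{R\in\{dB,s!,d!\}}$ is a square factorization system for the abstract rewriting system $(\Lambda_!, \to_F)$, where $\Lambda_!$ is the set of terms of the Distant Bang Calculus.
   Context: Distant Bang Calculus. Terms $\Lambda_!$: $t,u,s ::= x \mid t\,u \mid \lambda x.t \mid !t \mid \mathrm{der}(t) \mid t[x\backslash u]$; $\lambda x.t$ and $t[x\backslash u]$ bind $x$ in $t$; terms up to $\alpha$-conversion; $t\{x:=u\}$ is capture-avoiding substitution. Contexts have one hole $\square$, $C\langle t\rangle$ is plugging. Full contexts $F ::= \square \mid F\,t \mid t\,F \mid \lambda x.F \mid !F \mid \mathrm{der}(F) \mid F[x\backslash t] \mid t[x\backslash F]$; surface contexts $S ::= \square \mid S\,t \mid t\,S \mid \lambda x.S \mid \mathrm{der}(S) \mid S[x\backslash t] \mid t[x\backslash S]$; internal contexts $I ::= !F \mid S^*\langle I\rangle$ with $S^*$ a surface context different from $\square$ (equivalently, full contexts that are not surface contexts); list contexts $L ::= \square \mid L[x\backslash t]$. Rules (capture-free w.r.t. $L$): $(dB)$ $L\langle \lambda x.t\rangle\,u \mapsto L\langle t[x\backslash u]\rangle$; $(s!)$ $t[x\backslash L\langle !u\rangle] \mapsto L\langle t\{x:=u\}\rangle$; $(d!)$ $\mathrm{der}(L\langle !t\rangle) \mapsto L\langle t\rangle$. $\to_{S\langle R\rangle}$ (resp. $\to_{I\langle R\rangle}$, $\to_{F\langle R\rangle}$) is the closure of rule $R$ under surface (resp. internal, full) contexts;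 $\to_F=\bigcup_R\to_{F\langle R\rangle}$. Square factorization system: for an abstract rewriting system $(A,\to)$, a family $(\to_{\circ k},\to_{\bullet k})_{k\in K}$ of pairs of relations on $A$ is an SFS if, writing $\to_k := \to_{\circ k}\cup\to_{\bullet k}$: $\to=\bigcup_{k\in K}\to_k$; (Termination) each $\to_{\circ k}$ is terminating; (Row-swaps) for every $k$, $\to_{\bullet k}\to_{\circ k}\ \subseteq\ \to_{\circ k}^+\to_{\bullet k}^*$; (Diagonal-swaps) for all $k_1\neq k_2$, $\to_{\bullet k_1}\to_{\circ k_2}\ \subseteq\ \to_{\circ k_2}\to_{k_1}^*$. Juxtaposition denotes relational composition in sequence ($a \to_1\to_2 c$ iff $a\to_1 b\to_2 c$ for some $b$); $^+$, $^*$ are transitive and reflexive-transitive closures. -}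

module Defs where

open import Data.Nat using (ℕ; zero; suc; _+_)
open import Data.List using (List; []; _∷_; length)
open import Data.Product using (Σ; ∃; _×_; _,_)
open import Data.Sum using (_⊎_)
open import Data.Unit using (⊤)
open import Level using (0ℓ)
open import Relation.Nullary using (¬_)
open import Relation.Binary.Core using (Rel; _⇒_)
open import Relation.Binary.PropositionalEquality using (_≡_)
open import Relation.Binary.Construct.Closure.Transitive using (TransClosure)
open import Relation.Binary.Construct.Closure.ReflexiveTransitive using (Star)
open import Induction.WellFounded using (WellFounded)

Terminating : {A : Set} → Rel A 0ℓ → Set
Terminating _⟶_ = WellFounded (λ b a → a ⟶ b)

_∪_ : {A : Set} → Rel A 0ℓ → Rel A 0ℓ → Rel A 0ℓ
(R ∪ Q) a b = R a b ⊎ Q a b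

_⨾_ : {A : Set} → Rel A 0ℓ → Rel A 0ℓ → Rel A 0ℓ
(R ⨾ Q) a c = ∃ λ b → R a b × Q b c

record SFS {A : Set} (_⟶_ : Rel A 0ℓ) (K : Set)
           (∘ : K → Rel A 0ℓ) (• : K → Rel A 0ℓ) : Set₁ where
  field
    union       : ∀ a b → (a ⟶ b → Σ K λ k → (∘ k ∪ • k) a b)
                        × (Σ K (λ k → (∘ k ∪ • k) a b) → a ⟶ b)
    termination : ∀ k → Terminating (∘ k)
    row-swap    : ∀ k → (• k ⨾ ∘ k) ⇒ (TransClosure (∘ k) ⨾ Star (• k))
    diag-swap   : ∀ k₁ k₂ → ¬ (k₁ ≡ k₂) →
                  (• k₁ ⨾ ∘ k₂) ⇒ (∘ k₂ ⨾ Star (∘ k₁ ∪ • k₁))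

-- Terms of the Distant Bang Calculus, with de Bruijn indices
-- (so α-equivalent terms are identical).

data Tm : Set where
  var  : ℕ → Tm
  app  : Tm → Tm → Tm
  lam  : Tm → Tm
  bang : Tm → Tm
  der  : Tm → Tm
  esub : Tm → Tm → Tm     -- esub t u = t[x\u], x is index 0 in t

ext : (ℕ → ℕ) → ℕ → ℕ
ext ρ zero    = zero
ext ρ (suc k) = suc (ρ k)

rename : (ℕ → ℕ) → Tm → Tm
rename ρ (var k)    = var (ρ k)
rename ρ (app t u)  = app (rename ρ t) (rename ρ u)
rename ρ (lam t)    = lam (rename (ext ρ) t)
rename ρ (bang t)   = bang (rename ρ t)
rename ρ (der t)    = der (rename ρ t)
rename ρ (esub t u) = esub (rename (ext ρ) t) (rename ρ u)

exts : (ℕ → Tm) → ℕ → Tm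
exts σ zero    = var zero
exts σ (suc k) = rename suc (σ k)

subst : (ℕ → Tm) → Tm → Tm
subst σ (var k)    = σ k
subst σ (app t u)  = app (subst σ t) (subst σ u)
subst σ (lam t)    = lam (subst (exts σ) t)
subst σ (bang t)   = bang (subst σ t)
subst σ (der t)    = der (subst σ t)
subst σ (esub t u) = esub (subst (exts σ) t) (subst σ u)

_[0:=_] : Tm → Tm → Tm
t [0:= u ] = subst σ t
  where
  σ : ℕ → Tm
  σ zero    = u
  σ (suc k) = var k

-- List contexts  L ::= □ | L[x\t]
-- represented by the list of substituted terms, outermost first:
-- plugL (s₁ ∷ s₂ ∷ []) t = t[x\s₂][x\s₁]

ListCtx : Set
ListCtx = List Tm

plugL : ListCtx → Tm → Tm
plugL []      t = t
plugL (s ∷ L) t = esub (plugL L t) s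

-- Root rules. Capture-freeness w.r.t. L is realised by shifting the
-- pieces that move under the binders of L.

data Rule : Set where
  dB s! d! : Rule

data Root : Rule → Tm → Tm → Set where
  -- L⟨λx.t⟩ u ↦ L⟨t[x\u]⟩
  rdB : ∀ L t u →
        Root dB (app (plugL L (lam t)) u)
                (plugL L (esub t (rename (length L +_) u)))
  -- t[x\L⟨!u⟩] ↦ L⟨t{x:=u}⟩
  rs! : ∀ L t u →
        Root s! (esub t (plugL L (bang u)))
                (plugL L ((rename (ext (length L +_)) t) [0:= u ]))
  rd! : ∀ L t →
        Root d! (der (plugL L (bang t))) (plugL L t)

data Ctx : Set where
  hole  : Ctx
  appL  : Ctx → Tm → Ctx
  appR  : Tm → Ctx → Ctx
  lam   : Ctx → Ctx
  bang  : Ctx → Ctx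
  der   : Ctx → Ctx
  esubL : Ctx → Tm → Ctx
  esubR : Tm → Ctx → Ctx

plug : Ctx → Tm → Tm
plug hole        t = t
plug (appL C u)  t = app (plug C t) u
plug (appR u C)  t = app u (plug C t)
plug (lam C)     t = lam (plug C t)
plug (bang C)    t = bang (plug C t)
plug (der C)     t = der (plug C t)
plug (esubL C u) t = esub (plug C t) u
plug (esubR u C) t = esub u (plug C t)

data Surface : Ctx → Set where
  hole  : Surface hole
  appL  : ∀ {C} t → Surface C → Surface (appL C t)
  appR  : ∀ {C} t → Surface C → Surface (appR t C)
  lam   : ∀ {C} → Surface C → Surface (lam C)
  der   : ∀ {C} → Surface C → Surface (der C)
  esubL : ∀ {C} t → Surface C → Surface (esubL C t)
  esubR : ∀ {C} t → Surface C → Surface (esubR t C)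

data Internal : Ctx → Set where
  bang  : ∀ C → Internal (bang C)
  appL  : ∀ {C} t → Internal C → Internal (appL C t)
  appR  : ∀ {C} t → Internal C → Internal (appR t C)
  lam   : ∀ {C} → Internal C → Internal (lam C)
  der   : ∀ {C} → Internal C → Internal (der C)
  esubL : ∀ {C} t → Internal C → Internal (esubL C t)
  esubR : ∀ {C} t → Internal C → Internal (esubR t C)

Closure : (Ctx → Set) → Rule → Tm → Tm → Set
Closure P R t u = Σ Ctx λ C → P C × Σ Tm λ t₀ → Σ Tm λ u₀ →
                  Root R t₀ u₀ × (t ≡ plug C t₀) × (u ≡ plug C u₀)

Full : Ctx → Set
Full _ = ⊤

_→S⟨_⟩_ : Tm → Rule → Tm → Set
t →S⟨ R ⟩ u = Closure Surface R t u

_→I⟨_⟩_ : Tm → Rule → Tm → Set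
t →I⟨ R ⟩ u = Closure Internal R t u

_→F⟨_⟩_ : Tm → Rule → Tm → Set
t →F⟨ R ⟩ u = Closure Full R t u

_→F_ : Tm → Tm → Set
t →F u = Σ Rule λ R → t →F⟨ R ⟩ u

-- Every →F-step is surface or internal according to whether its context
-- goes under a !.  Everything rests on one swap: for arbitrary rules R₁, R₂,
-- an internal R₁-step followed by a surface R₂-step can be replaced by a
-- surface R₂-step followed by surface R₁-steps and then internal R₁-steps.
-- An internal step is never at the root, so it lies either in a part of
-- the surface redex that the rule moves intact (one internal step after),
-- or inside the box consumed by an s!- or d!-redex, where the substitution
-- may copy it and expose the copies at the surface.  Row- and diagonal
-- swaps are both instances.  Surface reductions terminate because dB
-- decreases the number of applications and s!, d! decrease a weight in
-- which explicitly substituted variables cost as much as their argument.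
module Submission where

open import Defs
open import Data.Nat using (ℕ; zero; suc; _+_; _≤_; _<_; s≤s)
open import Data.Nat.Properties
open import Algebra.Properties.CommutativeSemigroup +-commutativeSemigroup using (xy∙z≈xz∙y)
open import Data.Nat.Induction using (<-wellFounded)
open import Data.List using ([]; _∷_; length)
open import Data.Product using (∃; _×_; _,_)
open import Data.Sum using (_⊎_; inj₁; inj₂)
open import Data.Unit using (tt)
open import Function using (_∘_; id)
open import Relation.Binary.PropositionalEquality
  using (_≡_; _≗_; refl; sym; trans; cong; cong₂; subst₂; module ≡-Reasoning)
open import Relation.Binary.Construct.Closure.Transitive using (TransClosure; [_]; _∷_)
open import Relation.Binary.Construct.Closure.ReflexiveTransitive using (Star; ε; _◅_; _◅◅_; gmap)
open import Relation.Binary.Construct.On as On using ()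
open import Induction.WellFounded using (module Subrelation)

infixr 5 _•_

_•_ : {A : Set} → A → (ℕ → A) → ℕ → A
(a • f) zero    = a
(a • f) (suc k) = f k

single : Tm → ℕ → Tm
single u = u • var

ext-cong : ∀ {ρ ρ′} → ρ ≗ ρ′ → ext ρ ≗ ext ρ′
ext-cong e zero    = refl
ext-cong e (suc k) = cong suc (e k)

rename-cong : ∀ {ρ ρ′} → ρ ≗ ρ′ → rename ρ ≗ rename ρ′
rename-cong e (var k)    = cong var (e k)
rename-cong e (app t u)  = cong₂ app (rename-cong e t) (rename-cong e u)
rename-cong e (lam t)    = cong lam (rename-cong (ext-cong e) t)
rename-cong e (bang t)   = cong bang (rename-cong e t)
rename-cong e (der t)    = cong der (rename-cong e t)
rename-cong e (esub t u) = cong₂ esub (rename-cong (ext-cong e) t) (rename-cong e u)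

exts-cong : ∀ {σ σ′} → σ ≗ σ′ → exts σ ≗ exts σ′
exts-cong e zero    = refl
exts-cong e (suc k) = cong (rename suc) (e k)

subst-cong : ∀ {σ σ′} → σ ≗ σ′ → subst σ ≗ subst σ′
subst-cong e (var k)    = e k
subst-cong e (app t u)  = cong₂ app (subst-cong e t) (subst-cong e u)
subst-cong e (lam t)    = cong lam (subst-cong (exts-cong e) t)
subst-cong e (bang t)   = cong bang (subst-cong e t)
subst-cong e (der t)    = cong der (subst-cong e t)
subst-cong e (esub t u) = cong₂ esub (subst-cong (exts-cong e) t) (subst-cong e u)

ext-∘ : ∀ ρ ρ′ → ext ρ ∘ ext ρ′ ≗ ext (ρ ∘ ρ′)
ext-∘ ρ ρ′ zero    = refl
ext-∘ ρ ρ′ (suc k) = refl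

rename-∘ : ∀ ρ ρ′ → rename ρ ∘ rename ρ′ ≗ rename (ρ ∘ ρ′)
rename-∘ ρ ρ′ (var k)    = refl
rename-∘ ρ ρ′ (app t u)  = cong₂ app (rename-∘ ρ ρ′ t) (rename-∘ ρ ρ′ u)
rename-∘ ρ ρ′ (lam t)    =
  cong lam (trans (rename-∘ (ext ρ) (ext ρ′) t) (rename-cong (ext-∘ ρ ρ′) t))
rename-∘ ρ ρ′ (bang t)   = cong bang (rename-∘ ρ ρ′ t)
rename-∘ ρ ρ′ (der t)    = cong der (rename-∘ ρ ρ′ t)
rename-∘ ρ ρ′ (esub t u) =
  cong₂ esub (trans (rename-∘ (ext ρ) (ext ρ′) t) (rename-cong (ext-∘ ρ ρ′) t))
             (rename-∘ ρ ρ′ u)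

var-ext : ∀ ρ → var ∘ ext ρ ≗ exts (var ∘ ρ)
var-ext ρ zero    = refl
var-ext ρ (suc k) = refl

rename-is-subst : ∀ ρ → rename ρ ≗ subst (var ∘ ρ)
rename-is-subst ρ (var k)    = refl
rename-is-subst ρ (app t u)  = cong₂ app (rename-is-subst ρ t) (rename-is-subst ρ u)
rename-is-subst ρ (lam t)    =
  cong lam (trans (rename-is-subst (ext ρ) t) (subst-cong (var-ext ρ) t))
rename-is-subst ρ (bang t)   = cong bang (rename-is-subst ρ t)
rename-is-subst ρ (der t)    = cong der (rename-is-subst ρ t)
rename-is-subst ρ (esub t u) =
  cong₂ esub (trans (rename-is-subst (ext ρ) t) (subst-cong (var-ext ρ) t))
             (rename-is-subst ρ u)

exts-ext : ∀ σ ρ → exts σ ∘ ext ρ ≗ exts (σ ∘ ρ)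
exts-ext σ ρ zero    = refl
exts-ext σ ρ (suc k) = refl

subst-rename : ∀ σ ρ → subst σ ∘ rename ρ ≗ subst (σ ∘ ρ)
subst-rename σ ρ (var k)    = refl
subst-rename σ ρ (app t u)  = cong₂ app (subst-rename σ ρ t) (subst-rename σ ρ u)
subst-rename σ ρ (lam t)    =
  cong lam (trans (subst-rename (exts σ) (ext ρ) t) (subst-cong (exts-ext σ ρ) t))
subst-rename σ ρ (bang t)   = cong bang (subst-rename σ ρ t)
subst-rename σ ρ (der t)    = cong der (subst-rename σ ρ t)
subst-rename σ ρ (esub t u) =
  cong₂ esub (trans (subst-rename (exts σ) (ext ρ) t) (subst-cong (exts-ext σ ρ) t))
             (subst-rename σ ρ u)

rename-exts : ∀ ρ σ → rename (ext ρ) ∘ exts σ ≗ exts (rename ρ ∘ σ)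
rename-exts ρ σ zero    = refl
rename-exts ρ σ (suc k) =
  trans (rename-∘ (ext ρ) suc (σ k)) (sym (rename-∘ suc ρ (σ k)))

rename-subst : ∀ ρ σ → rename ρ ∘ subst σ ≗ subst (rename ρ ∘ σ)
rename-subst ρ σ (var k)    = refl
rename-subst ρ σ (app t u)  = cong₂ app (rename-subst ρ σ t) (rename-subst ρ σ u)
rename-subst ρ σ (lam t)    =
  cong lam (trans (rename-subst (ext ρ) (exts σ) t) (subst-cong (rename-exts ρ σ) t))
rename-subst ρ σ (bang t)   = cong bang (rename-subst ρ σ t)
rename-subst ρ σ (der t)    = cong der (rename-subst ρ σ t)
rename-subst ρ σ (esub t u) =
  cong₂ esub (trans (rename-subst (ext ρ) (exts σ) t) (subst-cong (rename-exts ρ σ) t))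
             (rename-subst ρ σ u)

subst-exts : ∀ τ σ → subst (exts τ) ∘ exts σ ≗ exts (subst τ ∘ σ)
subst-exts τ σ zero    = refl
subst-exts τ σ (suc k) =
  trans (subst-rename (exts τ) suc (σ k)) (sym (rename-subst suc τ (σ k)))

subst-∘ : ∀ τ σ → subst τ ∘ subst σ ≗ subst (subst τ ∘ σ)
subst-∘ τ σ (var k)    = refl
subst-∘ τ σ (app t u)  = cong₂ app (subst-∘ τ σ t) (subst-∘ τ σ u)
subst-∘ τ σ (lam t)    =
  cong lam (trans (subst-∘ (exts τ) (exts σ) t) (subst-cong (subst-exts τ σ) t))
subst-∘ τ σ (bang t)   = cong bang (subst-∘ τ σ t)
subst-∘ τ σ (der t)    = cong der (subst-∘ τ σ t)
subst-∘ τ σ (esub t u) =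
  cong₂ esub (trans (subst-∘ (exts τ) (exts σ) t) (subst-cong (subst-exts τ σ) t))
             (subst-∘ τ σ u)

exts-var : exts var ≗ var
exts-var zero    = refl
exts-var (suc k) = refl

subst-var : subst var ≗ id
subst-var (var k)    = refl
subst-var (app t u)  = cong₂ app (subst-var t) (subst-var u)
subst-var (lam t)    = cong lam (trans (subst-cong exts-var t) (subst-var t))
subst-var (bang t)   = cong bang (subst-var t)
subst-var (der t)    = cong der (subst-var t)
subst-var (esub t u) = cong₂ esub (trans (subst-cong exts-var t) (subst-var t)) (subst-var u)

rename-id : rename id ≗ id
rename-id t = trans (rename-is-subst id t) (subst-var t)

subst-rename-square : ∀ {σ σ′ ρ ρ′} → σ′ ∘ ρ ≗ rename ρ′ ∘ σ →
                      subst σ′ ∘ rename ρ ≗ rename ρ′ ∘ subst σ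
subst-rename-square {σ} {σ′} {ρ} {ρ′} sq t =
  trans (subst-rename σ′ ρ t) (trans (subst-cong sq t) (sym (rename-subst ρ′ σ t)))

exts-ext-square : ∀ {σ σ′ ρ ρ′} → σ′ ∘ ρ ≗ rename ρ′ ∘ σ →
                  exts σ′ ∘ ext ρ ≗ rename (ext ρ′) ∘ exts σ
exts-ext-square         sq zero    = refl
exts-ext-square {σ} {ρ′ = ρ′} sq (suc k) =
  trans (cong (rename suc) (sq k))
        (trans (rename-∘ suc ρ′ (σ k)) (sym (rename-∘ (ext ρ′) suc (σ k))))

[0:=]-is-subst : ∀ t u → t [0:= u ] ≡ subst (single u) t
[0:=]-is-subst t u = subst-cong (λ { zero → refl ; (suc k) → refl }) t

subst-[0:=] : ∀ τ t u → subst τ (t [0:= u ]) ≡ (subst (exts τ) t) [0:= subst τ u ]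
subst-[0:=] τ t u = begin
    subst τ (t [0:= u ])                           ≡⟨ cong (subst τ) ([0:=]-is-subst t u) ⟩
    subst τ (subst (single u) t)                   ≡⟨ subst-∘ τ (single u) t ⟩
    subst (subst τ ∘ single u) t                   ≡⟨ subst-cong single-exts t ⟩
    subst (subst (single u′) ∘ exts τ) t           ≡˘⟨ subst-∘ (single u′) (exts τ) t ⟩
    subst (single u′) (subst (exts τ) t)           ≡˘⟨ [0:=]-is-subst (subst (exts τ) t) u′ ⟩
    (subst (exts τ) t) [0:= u′ ]                   ∎
  where
  open ≡-Reasoning
  u′ = subst τ u
  single-exts : subst τ ∘ single u ≗ subst (single u′) ∘ exts τ
  single-exts zero    = refl
  single-exts (suc k) = sym (trans (subst-rename (single u′) suc (τ k)) (subst-var (τ k)))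

extsⁿ : ℕ → (ℕ → Tm) → ℕ → Tm
extsⁿ zero    σ = σ
extsⁿ (suc n) σ = extsⁿ n (exts σ)

substL : (ℕ → Tm) → ListCtx → ListCtx
substL σ []      = []
substL σ (s ∷ L) = subst σ s ∷ substL (exts σ) L

length-substL : ∀ σ L → length (substL σ L) ≡ length L
length-substL σ []      = refl
length-substL σ (s ∷ L) = cong suc (length-substL (exts σ) L)

subst-plugL : ∀ σ L t →
              subst σ (plugL L t) ≡ plugL (substL σ L) (subst (extsⁿ (length L) σ) t)
subst-plugL σ []      t = refl
subst-plugL σ (s ∷ L) t = cong (λ z → esub z (subst σ s)) (subst-plugL (exts σ) L t)

extsⁿ-shift : ∀ n σ → extsⁿ n σ ∘ (n +_) ≗ rename (n +_) ∘ σ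
extsⁿ-shift zero    σ k = sym (rename-id (σ k))
extsⁿ-shift (suc n) σ k = begin
    extsⁿ n (exts σ) (suc n + k)        ≡˘⟨ cong (extsⁿ n (exts σ)) (+-suc n k) ⟩
    extsⁿ n (exts σ) (n + suc k)        ≡⟨ extsⁿ-shift n (exts σ) (suc k) ⟩
    rename (n +_) (rename suc (σ k))    ≡⟨ rename-∘ (n +_) suc (σ k) ⟩
    rename ((n +_) ∘ suc) (σ k)         ≡⟨ rename-cong (+-suc n) (σ k) ⟩
    rename (suc n +_) (σ k)             ∎
  where open ≡-Reasoning

Root-subst : ∀ {R a b} σ → Root R a b → Root R (subst σ a) (subst σ b)
Root-subst σ (rdB L t u) =
  subst₂ (Root dB) (cong (λ z → app z (subst σ u)) (sym (subst-plugL σ L (lam t))))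
                   (sym (trans (subst-plugL σ L _) (cong (λ z → plugL L′ (esub T z)) shift-u)))
                   (rdB L′ T (subst σ u))
  where
  L′ = substL σ L
  T  = subst (exts (extsⁿ (length L) σ)) t
  shift-u : subst (extsⁿ (length L) σ) (rename (length L +_) u)
          ≡ rename (length L′ +_) (subst σ u)
  shift-u = trans (subst-rename-square (extsⁿ-shift (length L) σ) u)
                  (cong (λ m → rename (m +_) (subst σ u)) (sym (length-substL σ L)))
Root-subst σ (rs! L t u) =
  subst₂ (Root s!) (cong (esub T) (sym (subst-plugL σ L (bang u))))
                   (sym (trans (subst-plugL σ L _) (cong (plugL L′) contract)))
                   (rs! L′ T U)
  where
  open ≡-Reasoning
  n  = length L
  σₙ = extsⁿ n σ
  L′ = substL σ L
  T  = subst (exts σ) t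
  U  = subst σₙ u
  contract : subst σₙ (rename (ext (n +_)) t [0:= u ]) ≡ rename (ext (length L′ +_)) T [0:= U ]
  contract = begin
      subst σₙ (rename (ext (n +_)) t [0:= u ])
    ≡⟨ subst-[0:=] σₙ (rename (ext (n +_)) t) u ⟩
      subst (exts σₙ) (rename (ext (n +_)) t) [0:= U ]
    ≡⟨ cong (_[0:= U ]) (subst-rename-square (exts-ext-square (extsⁿ-shift n σ)) t) ⟩
      rename (ext (n +_)) T [0:= U ]
    ≡˘⟨ cong (λ m → rename (ext (m +_)) T [0:= U ]) (length-substL σ L) ⟩
      rename (ext (length L′ +_)) T [0:= U ]
    ∎
Root-subst σ (rd! L t) =
  subst₂ (Root d!) (cong der (sym (subst-plugL σ L (bang t)))) (sym (subst-plugL σ L t))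
                   (rd! (substL σ L) (subst (extsⁿ (length L) σ) t))

data SurfaceStep (R : Rule) : Tm → Tm → Set where
  root  : ∀ {a b} → Root R a b → SurfaceStep R a b
  appL  : ∀ {a b c} → SurfaceStep R a b → SurfaceStep R (app a c) (app b c)
  appR  : ∀ {a b c} → SurfaceStep R a b → SurfaceStep R (app c a) (app c b)
  lam   : ∀ {a b} → SurfaceStep R a b → SurfaceStep R (lam a) (lam b)
  der   : ∀ {a b} → SurfaceStep R a b → SurfaceStep R (der a) (der b)
  esubL : ∀ {a b c} → SurfaceStep R a b → SurfaceStep R (esub a c) (esub b c)
  esubR : ∀ {a b c} → SurfaceStep R a b → SurfaceStep R (esub c a) (esub c b)

-- I ::= !F | S*⟨I⟩: under a box every step is internal.
data InternalStep (R : Rule) : Tm → Tm → Set where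
  bang  : ∀ {a b} → SurfaceStep R a b ⊎ InternalStep R a b →
          InternalStep R (bang a) (bang b)
  appL  : ∀ {a b c} → InternalStep R a b → InternalStep R (app a c) (app b c)
  appR  : ∀ {a b c} → InternalStep R a b → InternalStep R (app c a) (app c b)
  lam   : ∀ {a b} → InternalStep R a b → InternalStep R (lam a) (lam b)
  der   : ∀ {a b} → InternalStep R a b → InternalStep R (der a) (der b)
  esubL : ∀ {a b c} → InternalStep R a b → InternalStep R (esub a c) (esub b c)
  esubR : ∀ {a b c} → InternalStep R a b → InternalStep R (esub c a) (esub c b)

Step : Rule → Tm → Tm → Set
Step R = SurfaceStep R ∪ InternalStep R

SurfaceStep-subst : ∀ {R a b} σ → SurfaceStep R a b → SurfaceStep R (subst σ a) (subst σ b)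
SurfaceStep-subst σ (root r)  = root (Root-subst σ r)
SurfaceStep-subst σ (appL p)  = appL (SurfaceStep-subst σ p)
SurfaceStep-subst σ (appR p)  = appR (SurfaceStep-subst σ p)
SurfaceStep-subst σ (lam p)   = lam (SurfaceStep-subst (exts σ) p)
SurfaceStep-subst σ (der p)   = der (SurfaceStep-subst σ p)
SurfaceStep-subst σ (esubL p) = esubL (SurfaceStep-subst (exts σ) p)
SurfaceStep-subst σ (esubR p) = esubR (SurfaceStep-subst σ p)

InternalStep-subst : ∀ {R a b} σ → InternalStep R a b → InternalStep R (subst σ a) (subst σ b)
InternalStep-subst σ (bang (inj₁ p)) = bang (inj₁ (SurfaceStep-subst σ p))
InternalStep-subst σ (bang (inj₂ p)) = bang (inj₂ (InternalStep-subst σ p))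
InternalStep-subst σ (appL p)        = appL (InternalStep-subst σ p)
InternalStep-subst σ (appR p)        = appR (InternalStep-subst σ p)
InternalStep-subst σ (lam p)         = lam (InternalStep-subst (exts σ) p)
InternalStep-subst σ (der p)         = der (InternalStep-subst σ p)
InternalStep-subst σ (esubL p)       = esubL (InternalStep-subst (exts σ) p)
InternalStep-subst σ (esubR p)       = esubR (InternalStep-subst σ p)

SurfaceStep-rename : ∀ {R a b} ρ → SurfaceStep R a b → SurfaceStep R (rename ρ a) (rename ρ b)
SurfaceStep-rename {R} {a} {b} ρ p =
  subst₂ (SurfaceStep R) (sym (rename-is-subst ρ a)) (sym (rename-is-subst ρ b))
         (SurfaceStep-subst (var ∘ ρ) p)

InternalStep-rename : ∀ {R a b} ρ → InternalStep R a b → InternalStep R (rename ρ a) (rename ρ b)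
InternalStep-rename {R} {a} {b} ρ p =
  subst₂ (InternalStep R) (sym (rename-is-subst ρ a)) (sym (rename-is-subst ρ b))
         (InternalStep-subst (var ∘ ρ) p)

InternalStep-[0:=] : ∀ {R a b} u → InternalStep R a b → InternalStep R (a [0:= u ]) (b [0:= u ])
InternalStep-[0:=] {R} {a} {b} u p =
  subst₂ (InternalStep R) (sym ([0:=]-is-subst a u)) (sym ([0:=]-is-subst b u))
         (InternalStep-subst (single u) p)

InternalStep-plugL : ∀ {R a b} L → InternalStep R a b → InternalStep R (plugL L a) (plugL L b)
InternalStep-plugL []      p = p
InternalStep-plugL (s ∷ L) p = esubL (InternalStep-plugL L p)

Factorized : Rule → Tm → Tm → Set
Factorized R = Star (SurfaceStep R) ⨾ Star (InternalStep R)

Factorized-refl : ∀ {R a} → Factorized R a a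
Factorized-refl = _ , ε , ε

Factorized-step : ∀ {R a b} → Step R a b → Factorized R a b
Factorized-step (inj₁ p) = _ , p ◅ ε , ε
Factorized-step (inj₂ p) = _ , ε , p ◅ ε

Factorized-app : ∀ {R a a′ b b′} → Factorized R a a′ → Factorized R b b′ →
                 Factorized R (app a b) (app a′ b′)
Factorized-app (_ , s₁ , i₁) (_ , s₂ , i₂) =
  _ , gmap _ appL s₁ ◅◅ gmap _ appR s₂ , gmap _ appL i₁ ◅◅ gmap _ appR i₂

Factorized-esub : ∀ {R a a′ b b′} → Factorized R a a′ → Factorized R b b′ →
                  Factorized R (esub a b) (esub a′ b′)
Factorized-esub (_ , s₁ , i₁) (_ , s₂ , i₂) =
  _ , gmap _ esubL s₁ ◅◅ gmap _ esubR s₂ , gmap _ esubL i₁ ◅◅ gmap _ esubR i₂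

Factorized-lam : ∀ {R a a′} → Factorized R a a′ → Factorized R (lam a) (lam a′)
Factorized-lam (_ , s , i) = _ , gmap lam lam s , gmap lam lam i

Factorized-der : ∀ {R a a′} → Factorized R a a′ → Factorized R (der a) (der a′)
Factorized-der (_ , s , i) = _ , gmap der der s , gmap der der i

Factorized-bang : ∀ {R a a′} → Factorized R a a′ → Factorized R (bang a) (bang a′)
Factorized-bang (_ , s , i) =
  _ , ε , gmap bang (λ p → bang (inj₁ p)) s ◅◅ gmap bang (λ p → bang (inj₂ p)) i

Factorized-rename : ∀ {R a a′} ρ → Factorized R a a′ → Factorized R (rename ρ a) (rename ρ a′)
Factorized-rename ρ (_ , s , i) =
  _ , gmap (rename ρ) (SurfaceStep-rename ρ) s , gmap (rename ρ) (InternalStep-rename ρ) i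

Factorized-exts : ∀ {R σ σ′} → (∀ k → Factorized R (σ k) (σ′ k)) →
                  ∀ k → Factorized R (exts σ k) (exts σ′ k)
Factorized-exts h zero    = Factorized-refl
Factorized-exts h (suc k) = Factorized-rename suc (h k)

Factorized-subst : ∀ {R σ σ′} → (∀ k → Factorized R (σ k) (σ′ k)) →
                   ∀ t → Factorized R (subst σ t) (subst σ′ t)
Factorized-subst h (var k)    = h k
Factorized-subst h (app t u)  = Factorized-app (Factorized-subst h t) (Factorized-subst h u)
Factorized-subst h (lam t)    = Factorized-lam (Factorized-subst (Factorized-exts h) t)
Factorized-subst h (bang t)   = Factorized-bang (Factorized-subst h t)
Factorized-subst h (der t)    = Factorized-der (Factorized-subst h t)
Factorized-subst h (esub t u) =
  Factorized-esub (Factorized-subst (Factorized-exts h) t) (Factorized-subst h u)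

Factorized-plugL : ∀ {R a b} L → Factorized R a b → Factorized R (plugL L a) (plugL L b)
Factorized-plugL []      m = m
Factorized-plugL (s ∷ L) m = Factorized-esub (Factorized-plugL L m) Factorized-refl

Factorized-[0:=] : ∀ {R u₀ u} t → Step R u₀ u → Factorized R (t [0:= u₀ ]) (t [0:= u ])
Factorized-[0:=] {R} {u₀} {u} t p =
  subst₂ (Factorized R) (sym ([0:=]-is-subst t u₀)) (sym ([0:=]-is-subst t u))
         (Factorized-subst (λ { zero → Factorized-step p ; (suc k) → Factorized-refl }) t)

data ListStep (R : Rule) : ListCtx → ListCtx → Set where
  here  : ∀ {s₀ s L} → InternalStep R s₀ s → ListStep R (s₀ ∷ L) (s ∷ L)
  there : ∀ {s L₀ L} → ListStep R L₀ L → ListStep R (s ∷ L₀) (s ∷ L)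

-- The plugged term may depend on the length of the list context (the
-- shifts of Root do), which a ListStep does not change.
ListStep-plugL : ∀ {R L₀ L} → ListStep R L₀ L → (X : ℕ → Tm) →
                 InternalStep R (plugL L₀ (X (length L₀))) (plugL L (X (length L)))
ListStep-plugL (here q)  X = esubR q
ListStep-plugL (there l) X = esubL (ListStep-plugL l (X ∘ suc))

invert-InternalStep-lam :
  ∀ {R} L t a → InternalStep R a (plugL L (lam t)) →
  (∃ λ t₀ → a ≡ plugL L (lam t₀) × InternalStep R t₀ t) ⊎
  (∃ λ L₀ → a ≡ plugL L₀ (lam t) × ListStep R L₀ L)
invert-InternalStep-lam []      t (lam a)     (lam q)   = inj₁ (a , refl , q)
invert-InternalStep-lam (s ∷ L) t (esub a s)  (esubL q) with invert-InternalStep-lam L t a q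
... | inj₁ (t₀ , refl , q′) = inj₁ (t₀ , refl , q′)
... | inj₂ (L₀ , refl , l)  = inj₂ (s ∷ L₀ , refl , there l)
invert-InternalStep-lam (s ∷ L) t (esub _ s₀) (esubR q) = inj₂ (s₀ ∷ L , refl , here q)

invert-InternalStep-bang :
  ∀ {R} L u a → InternalStep R a (plugL L (bang u)) →
  (∃ λ u₀ → a ≡ plugL L (bang u₀) × Step R u₀ u) ⊎
  (∃ λ L₀ → a ≡ plugL L₀ (bang u) × ListStep R L₀ L)
invert-InternalStep-bang []      u (bang a)    (bang q)  = inj₁ (a , refl , q)
invert-InternalStep-bang (s ∷ L) u (esub a s)  (esubL q) with invert-InternalStep-bang L u a q
... | inj₁ (u₀ , refl , q′) = inj₁ (u₀ , refl , q′)
... | inj₂ (L₀ , refl , l)  = inj₂ (s ∷ L₀ , refl , there l)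
invert-InternalStep-bang (s ∷ L) u (esub _ s₀) (esubR q) = inj₂ (s₀ ∷ L , refl , here q)

internal-root-swap : ∀ {R₁ R₂ a b c} → InternalStep R₁ a b → Root R₂ b c →
                     (SurfaceStep R₂ ⨾ Factorized R₁) a c
internal-root-swap (appL q) (rdB L t u) with invert-InternalStep-lam L t _ q
... | inj₁ (t₀ , refl , q′) =
  _ , root (rdB L t₀ u) , Factorized-step (inj₂ (InternalStep-plugL L (esubL q′)))
... | inj₂ (L₀ , refl , l)  =
  _ , root (rdB L₀ t u) , Factorized-step (inj₂ (ListStep-plugL l (λ n → esub t (rename (n +_) u))))
internal-root-swap (appR q) (rdB L t u) =
  _ , root (rdB L t _) ,
  Factorized-step (inj₂ (InternalStep-plugL L (esubR (InternalStep-rename (length L +_) q))))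
internal-root-swap (esubL q) (rs! L t u) =
  _ , root (rs! L _ u) ,
  Factorized-step (inj₂ (InternalStep-plugL L
    (InternalStep-[0:=] u (InternalStep-rename (ext (length L +_)) q))))
internal-root-swap (esubR q) (rs! L t u) with invert-InternalStep-bang L u _ q
... | inj₁ (u₀ , refl , p)  =
  _ , root (rs! L t u₀) , Factorized-plugL L (Factorized-[0:=] (rename (ext (length L +_)) t) p)
... | inj₂ (L₀ , refl , l)  =
  _ , root (rs! L₀ t u) ,
  Factorized-step (inj₂ (ListStep-plugL l (λ n → rename (ext (n +_)) t [0:= u ])))
internal-root-swap (der q) (rd! L t) with invert-InternalStep-bang L t _ q
... | inj₁ (t₀ , refl , p)  = _ , root (rd! L t₀) , Factorized-plugL L (Factorized-step p)
... | inj₂ (L₀ , refl , l)  =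
  _ , root (rd! L₀ t) , Factorized-step (inj₂ (ListStep-plugL l (λ _ → t)))

internal-surface-swap : ∀ {R₁ R₂ a b c} → InternalStep R₁ a b → SurfaceStep R₂ b c →
                        (SurfaceStep R₂ ⨾ Factorized R₁) a c
internal-surface-swap q (root r) = internal-root-swap q r
internal-surface-swap (appL q) (appL p) with internal-surface-swap q p
... | _ , p′ , m = _ , appL p′ , Factorized-app m Factorized-refl
internal-surface-swap (appR q) (appL p) = _ , appL p , Factorized-step (inj₂ (appR q))
internal-surface-swap (appL q) (appR p) = _ , appR p , Factorized-step (inj₂ (appL q))
internal-surface-swap (appR q) (appR p) with internal-surface-swap q p
... | _ , p′ , m = _ , appR p′ , Factorized-app Factorized-refl m
internal-surface-swap (lam q) (lam p) with internal-surface-swap q p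
... | _ , p′ , m = _ , lam p′ , Factorized-lam m
internal-surface-swap (der q) (der p) with internal-surface-swap q p
... | _ , p′ , m = _ , der p′ , Factorized-der m
internal-surface-swap (esubL q) (esubL p) with internal-surface-swap q p
... | _ , p′ , m = _ , esubL p′ , Factorized-esub m Factorized-refl
internal-surface-swap (esubR q) (esubL p) = _ , esubL p , Factorized-step (inj₂ (esubR q))
internal-surface-swap (esubL q) (esubR p) = _ , esubR p , Factorized-step (inj₂ (esubL q))
internal-surface-swap (esubR q) (esubR p) with internal-surface-swap q p
... | _ , p′ , m = _ , esubR p′ , Factorized-esub Factorized-refl m

Terminating-by : ∀ {A : Set} {_⟶_ : A → A → Set} (f : A → ℕ) →
                 (∀ {a b} → a ⟶ b → f b < f a) → Terminating _⟶_
Terminating-by f decreases = Subrelation.wellFounded decreases (On.wellFounded f <-wellFounded)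

apps : Tm → ℕ
apps (var k)    = 0
apps (app t u)  = suc (apps t + apps u)
apps (lam t)    = apps t
apps (bang t)   = apps t
apps (der t)    = apps t
apps (esub t u) = apps t + apps u

apps-rename : ∀ ρ t → apps (rename ρ t) ≡ apps t
apps-rename ρ (var k)    = refl
apps-rename ρ (app t u)  = cong₂ (λ m n → suc (m + n)) (apps-rename ρ t) (apps-rename ρ u)
apps-rename ρ (lam t)    = apps-rename (ext ρ) t
apps-rename ρ (bang t)   = apps-rename ρ t
apps-rename ρ (der t)    = apps-rename ρ t
apps-rename ρ (esub t u) = cong₂ _+_ (apps-rename (ext ρ) t) (apps-rename ρ u)

appsL : ListCtx → ℕ
appsL []      = 0
appsL (s ∷ L) = appsL L + apps s

apps-plugL : ∀ L t → apps (plugL L t) ≡ apps t + appsL L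
apps-plugL []      t = sym (+-identityʳ (apps t))
apps-plugL (s ∷ L) t =
  trans (cong (_+ apps s) (apps-plugL L t)) (+-assoc (apps t) (appsL L) (apps s))

apps-plug-< : ∀ C {a b} → apps b < apps a → apps (plug C b) < apps (plug C a)
apps-plug-< hole        lt = lt
apps-plug-< (appL C t)  lt = s≤s (+-monoˡ-< (apps t) (apps-plug-< C lt))
apps-plug-< (appR t C)  lt = s≤s (+-monoʳ-< (apps t) (apps-plug-< C lt))
apps-plug-< (lam C)     lt = apps-plug-< C lt
apps-plug-< (bang C)    lt = apps-plug-< C lt
apps-plug-< (der C)     lt = apps-plug-< C lt
apps-plug-< (esubL C t) lt = +-monoˡ-< (apps t) (apps-plug-< C lt)
apps-plug-< (esubR t C) lt = +-monoʳ-< (apps t) (apps-plug-< C lt)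

dB-decreases-apps : ∀ {a b} → Root dB a b → apps b < apps a
dB-decreases-apps (rdB L t u) = begin-strict
    apps (plugL L (esub t (rename (length L +_) u)))
  ≡⟨ apps-plugL L _ ⟩
    apps t + apps (rename (length L +_) u) + appsL L
  ≡⟨ cong (λ n → apps t + n + appsL L) (apps-rename _ u) ⟩
    apps t + apps u + appsL L
  ≡⟨ xy∙z≈xz∙y (apps t) (apps u) (appsL L) ⟩
    apps t + appsL L + apps u
  ≡˘⟨ cong (_+ apps u) (apps-plugL L (lam t)) ⟩
    apps (plugL L (lam t)) + apps u
  <⟨ n<1+n _ ⟩
    apps (app (plugL L (lam t)) u)
  ∎
  where open ≤-Reasoning

-- ρ weighs the free variables.  In t[x\u] each occurrence of x costs the
-- weight of u, so t[x\L⟨!u⟩] outweighs L⟨t{x:=u}⟩ whatever the number of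
-- occurrences.
weight : (ℕ → ℕ) → Tm → ℕ
weight ρ (var k)    = ρ k
weight ρ (app t u)  = suc (weight ρ t + weight ρ u)
weight ρ (lam t)    = suc (weight (0 • ρ) t)
weight ρ (bang t)   = suc (weight ρ t)
weight ρ (der t)    = suc (weight ρ t)
weight ρ (esub t u) = suc (weight (weight ρ u • ρ) t + weight ρ u)

•-cong : ∀ {A : Set} {a a′ : A} {f f′} → a ≡ a′ → f ≗ f′ → a • f ≗ a′ • f′
•-cong e h zero    = e
•-cong e h (suc k) = h k

•-ext : ∀ {A : Set} (a : A) f ρ → (a • f) ∘ ext ρ ≗ a • (f ∘ ρ)
•-ext a f ρ zero    = refl
•-ext a f ρ (suc k) = refl

weight-cong : ∀ {ρ ρ′} → ρ ≗ ρ′ → weight ρ ≗ weight ρ′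
weight-cong e (var k)    = e k
weight-cong e (app t u)  = cong₂ (λ m n → suc (m + n)) (weight-cong e t) (weight-cong e u)
weight-cong e (lam t)    = cong suc (weight-cong (•-cong refl e) t)
weight-cong e (bang t)   = cong suc (weight-cong e t)
weight-cong e (der t)    = cong suc (weight-cong e t)
weight-cong e (esub t u) =
  cong₂ (λ m n → suc (m + n)) (weight-cong (•-cong (weight-cong e u) e) t) (weight-cong e u)

weight-rename : ∀ ρ f t → weight ρ (rename f t) ≡ weight (ρ ∘ f) t
weight-rename ρ f (var k)    = refl
weight-rename ρ f (app t u)  =
  cong₂ (λ m n → suc (m + n)) (weight-rename ρ f t) (weight-rename ρ f u)
weight-rename ρ f (lam t)    =
  cong suc (trans (weight-rename (0 • ρ) (ext f) t) (weight-cong (•-ext 0 ρ f) t))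
weight-rename ρ f (bang t)   = cong suc (weight-rename ρ f t)
weight-rename ρ f (der t)    = cong suc (weight-rename ρ f t)
weight-rename ρ f (esub t u) =
  cong₂ (λ m n → suc (m + n))
        (trans (weight-rename (w • ρ) (ext f) t) (weight-cong ext-weight t))
        (weight-rename ρ f u)
  where
  w = weight ρ (rename f u)
  ext-weight : (w • ρ) ∘ ext f ≗ weight (ρ ∘ f) u • (ρ ∘ f)
  ext-weight zero    = weight-rename ρ f u
  ext-weight (suc k) = refl

weight-subst : ∀ ρ σ t → weight ρ (subst σ t) ≡ weight (weight ρ ∘ σ) t
weight-subst ρ σ (var k)    = refl
weight-subst ρ σ (app t u)  =
  cong₂ (λ m n → suc (m + n)) (weight-subst ρ σ t) (weight-subst ρ σ u)
weight-subst ρ σ (lam t)    =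
  cong suc (trans (weight-subst (0 • ρ) (exts σ) t) (weight-cong exts-weight t))
  where
  exts-weight : weight (0 • ρ) ∘ exts σ ≗ 0 • (weight ρ ∘ σ)
  exts-weight zero    = refl
  exts-weight (suc k) = weight-rename (0 • ρ) suc (σ k)
weight-subst ρ σ (bang t)   = cong suc (weight-subst ρ σ t)
weight-subst ρ σ (der t)    = cong suc (weight-subst ρ σ t)
weight-subst ρ σ (esub t u) =
  cong₂ (λ m n → suc (m + n))
        (trans (weight-subst (w • ρ) (exts σ) t) (weight-cong exts-weight t))
        (weight-subst ρ σ u)
  where
  w = weight ρ (subst σ u)
  exts-weight : weight (w • ρ) ∘ exts σ ≗ weight (weight ρ ∘ σ) u • (weight ρ ∘ σ)
  exts-weight zero    = weight-subst ρ σ u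
  exts-weight (suc k) = weight-rename (w • ρ) suc (σ k)

_≤ᵖ_ : (ℕ → ℕ) → (ℕ → ℕ) → Set
ρ ≤ᵖ ρ′ = ∀ k → ρ k ≤ ρ′ k

•-mono : ∀ {w w′ ρ ρ′} → w ≤ w′ → ρ ≤ᵖ ρ′ → (w • ρ) ≤ᵖ (w′ • ρ′)
•-mono le h zero    = le
•-mono le h (suc k) = h k

weight-mono : ∀ {ρ ρ′} → ρ ≤ᵖ ρ′ → ∀ t → weight ρ t ≤ weight ρ′ t
weight-mono h (var k)    = h k
weight-mono h (app t u)  = s≤s (+-mono-≤ (weight-mono h t) (weight-mono h u))
weight-mono h (lam t)    = s≤s (weight-mono (•-mono ≤-refl h) t)
weight-mono h (bang t)   = s≤s (weight-mono h t)
weight-mono h (der t)    = s≤s (weight-mono h t)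
weight-mono h (esub t u) =
  s≤s (+-mono-≤ (weight-mono (•-mono (weight-mono h u) h) t) (weight-mono h u))

weight-plug-< : ∀ C {a b} → (∀ ρ → weight ρ b < weight ρ a) →
                ∀ ρ → weight ρ (plug C b) < weight ρ (plug C a)
weight-plug-< hole        lt ρ = lt ρ
weight-plug-< (appL C t)  lt ρ = s≤s (+-monoˡ-< (weight ρ t) (weight-plug-< C lt ρ))
weight-plug-< (appR t C)  lt ρ = s≤s (+-monoʳ-< (weight ρ t) (weight-plug-< C lt ρ))
weight-plug-< (lam C)     lt ρ = s≤s (weight-plug-< C lt (0 • ρ))
weight-plug-< (bang C)    lt ρ = s≤s (weight-plug-< C lt ρ)
weight-plug-< (der C)     lt ρ = s≤s (weight-plug-< C lt ρ)
weight-plug-< (esubL C t) lt ρ = s≤s (+-monoˡ-< (weight ρ t) (weight-plug-< C lt _))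
weight-plug-< (esubR t C) lt ρ =
  s≤s (+-mono-≤-< (weight-mono (•-mono (<⇒≤ (weight-plug-< C lt ρ)) (λ _ → ≤-refl)) t)
                  (weight-plug-< C lt ρ))

weight-envL : (ℕ → ℕ) → ListCtx → ℕ → ℕ
weight-envL ρ []      = ρ
weight-envL ρ (s ∷ L) = weight-envL (weight ρ s • ρ) L

weightL : (ℕ → ℕ) → ListCtx → ℕ
weightL ρ []      = 0
weightL ρ (s ∷ L) = suc (weightL (weight ρ s • ρ) L + weight ρ s)

weight-plugL : ∀ ρ L t → weight ρ (plugL L t) ≡ weight (weight-envL ρ L) t + weightL ρ L
weight-plugL ρ []      t = sym (+-identityʳ _)
weight-plugL ρ (s ∷ L) t = begin
    suc (weight ρ′ (plugL L t) + w)    ≡⟨ cong (λ n → suc (n + w)) (weight-plugL ρ′ L t) ⟩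
    suc (x + weightL ρ′ L + w)         ≡⟨ cong suc (+-assoc x (weightL ρ′ L) w) ⟩
    suc (x + (weightL ρ′ L + w))       ≡˘⟨ +-suc x _ ⟩
    x + weightL ρ (s ∷ L)              ∎
  where
  open ≡-Reasoning
  w  = weight ρ s
  ρ′ = w • ρ
  x  = weight (weight-envL ρ′ L) t

weight-envL-shift : ∀ ρ L k → weight-envL ρ L (length L + k) ≡ ρ k
weight-envL-shift ρ []      k = refl
weight-envL-shift ρ (s ∷ L) k =
  trans (cong (weight-envL (weight ρ s • ρ) L) (sym (+-suc (length L) k)))
        (weight-envL-shift (weight ρ s • ρ) L (suc k))

s!-decreases-weight : ∀ {a b} → Root s! a b → ∀ ρ → weight ρ b < weight ρ a
s!-decreases-weight (rs! L t u) ρ = begin-strict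
    weight ρ (plugL L (t′ [0:= u ]))               ≡⟨ weight-plugL ρ L _ ⟩
    weight ρL (t′ [0:= u ]) + c                    ≡⟨ cong (_+ c) (cong (weight ρL) ([0:=]-is-subst t′ u)) ⟩
    weight ρL (subst (single u) t′) + c            ≡⟨ cong (_+ c) (weight-subst ρL (single u) t′) ⟩
    weight (weight ρL ∘ single u) t′ + c           ≡⟨ cong (_+ c) (weight-rename _ (ext (n +_)) t) ⟩
    weight (weight ρL ∘ single u ∘ ext (n +_)) t + c
      ≤⟨ +-mono-≤ (weight-mono bound t) (m≤n+m c (suc (weight ρL u))) ⟩
    weight (W • ρ) t + (suc (weight ρL u) + c)      ≡˘⟨ cong (weight (W • ρ) t +_) W≡ ⟩
    weight (W • ρ) t + W                           <⟨ n<1+n _ ⟩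
    weight ρ (esub t (plugL L (bang u)))           ∎
  where
  open ≤-Reasoning
  n  = length L
  t′ = rename (ext (n +_)) t
  ρL = weight-envL ρ L
  c  = weightL ρ L
  W  = weight ρ (plugL L (bang u))
  W≡ : W ≡ suc (weight ρL u) + c
  W≡ = weight-plugL ρ L (bang u)
  bound : (weight ρL ∘ single u ∘ ext (n +_)) ≤ᵖ (W • ρ)
  bound zero    = ≤-trans (≤-trans (n≤1+n _) (m≤m+n _ c)) (≤-reflexive (sym W≡))
  bound (suc k) = ≤-reflexive (weight-envL-shift ρ L k)

d!-decreases-weight : ∀ {a b} → Root d! a b → ∀ ρ → weight ρ b < weight ρ a
d!-decreases-weight (rd! L t) ρ =
  subst₂ _<_ (sym (weight-plugL ρ L t)) (sym (cong suc (weight-plugL ρ L (bang t))))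
         (s≤s (n≤1+n _))

surface-or-internal : ∀ C → Surface C ⊎ Internal C
surface-or-internal hole = inj₁ hole
surface-or-internal (bang C) = inj₂ (bang C)
surface-or-internal (appL C t) with surface-or-internal C
... | inj₁ s = inj₁ (appL t s)
... | inj₂ i = inj₂ (appL t i)
surface-or-internal (appR t C) with surface-or-internal C
... | inj₁ s = inj₁ (appR t s)
... | inj₂ i = inj₂ (appR t i)
surface-or-internal (lam C) with surface-or-internal C
... | inj₁ s = inj₁ (lam s)
... | inj₂ i = inj₂ (lam i)
surface-or-internal (der C) with surface-or-internal C
... | inj₁ s = inj₁ (der s)
... | inj₂ i = inj₂ (der i)
surface-or-internal (esubL C t) with surface-or-internal C
... | inj₁ s = inj₁ (esubL t s)
... | inj₂ i = inj₂ (esubL t i)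
surface-or-internal (esubR t C) with surface-or-internal C
... | inj₁ s = inj₁ (esubR t s)
... | inj₂ i = inj₂ (esubR t i)

Surface-plug : ∀ {R C a b} → Surface C → Root R a b → SurfaceStep R (plug C a) (plug C b)
Surface-plug hole        r = root r
Surface-plug (appL t s)  r = appL (Surface-plug s r)
Surface-plug (appR t s)  r = appR (Surface-plug s r)
Surface-plug (lam s)     r = lam (Surface-plug s r)
Surface-plug (der s)     r = der (Surface-plug s r)
Surface-plug (esubL t s) r = esubL (Surface-plug s r)
Surface-plug (esubR t s) r = esubR (Surface-plug s r)

Internal-plug : ∀ {R C a b} → Internal C → Root R a b → InternalStep R (plug C a) (plug C b)
Internal-plug (bang C) r with surface-or-internal C
... | inj₁ s = bang (inj₁ (Surface-plug s r))
... | inj₂ i = bang (inj₂ (Internal-plug i r))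
Internal-plug (appL t i)  r = appL (Internal-plug i r)
Internal-plug (appR t i)  r = appR (Internal-plug i r)
Internal-plug (lam i)     r = lam (Internal-plug i r)
Internal-plug (der i)     r = der (Internal-plug i r)
Internal-plug (esubL t i) r = esubL (Internal-plug i r)
Internal-plug (esubR t i) r = esubR (Internal-plug i r)

→S⇒SurfaceStep : ∀ {R a b} → a →S⟨ R ⟩ b → SurfaceStep R a b
→S⇒SurfaceStep (_ , s , _ , _ , r , refl , refl) = Surface-plug s r

→I⇒InternalStep : ∀ {R a b} → a →I⟨ R ⟩ b → InternalStep R a b
→I⇒InternalStep (_ , i , _ , _ , r , refl , refl) = Internal-plug i r

Closure-frame : ∀ {P Q : Ctx → Set} {R a b} {f : Tm → Tm} {K : Ctx → Ctx} →
                (∀ {C} → P C → Q (K C)) → (∀ C t → plug (K C) t ≡ f (plug C t)) →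
                Closure P R a b → Closure Q R (f a) (f b)
Closure-frame k e (C , pC , a₀ , b₀ , r , refl , refl) =
  _ , k pC , a₀ , b₀ , r , sym (e C a₀) , sym (e C b₀)

SurfaceStep⇒→S : ∀ {R a b} → SurfaceStep R a b → a →S⟨ R ⟩ b
SurfaceStep⇒→S (root r)  = hole , hole , _ , _ , r , refl , refl
SurfaceStep⇒→S (appL p)  = Closure-frame (appL _) (λ _ _ → refl) (SurfaceStep⇒→S p)
SurfaceStep⇒→S (appR p)  = Closure-frame (appR _) (λ _ _ → refl) (SurfaceStep⇒→S p)
SurfaceStep⇒→S (lam p)   = Closure-frame lam (λ _ _ → refl) (SurfaceStep⇒→S p)
SurfaceStep⇒→S (der p)   = Closure-frame der (λ _ _ → refl) (SurfaceStep⇒→S p)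
SurfaceStep⇒→S (esubL p) = Closure-frame (esubL _) (λ _ _ → refl) (SurfaceStep⇒→S p)
SurfaceStep⇒→S (esubR p) = Closure-frame (esubR _) (λ _ _ → refl) (SurfaceStep⇒→S p)

InternalStep⇒→I : ∀ {R a b} → InternalStep R a b → a →I⟨ R ⟩ b
InternalStep⇒→I (bang (inj₁ p)) =
  Closure-frame (λ {C} _ → bang C) (λ _ _ → refl) (SurfaceStep⇒→S p)
InternalStep⇒→I (bang (inj₂ p)) =
  Closure-frame (λ {C} _ → bang C) (λ _ _ → refl) (InternalStep⇒→I p)
InternalStep⇒→I (appL p)  = Closure-frame (appL _) (λ _ _ → refl) (InternalStep⇒→I p)
InternalStep⇒→I (appR p)  = Closure-frame (appR _) (λ _ _ → refl) (InternalStep⇒→I p)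
InternalStep⇒→I (lam p)   = Closure-frame lam (λ _ _ → refl) (InternalStep⇒→I p)
InternalStep⇒→I (der p)   = Closure-frame der (λ _ _ → refl) (InternalStep⇒→I p)
InternalStep⇒→I (esubL p) = Closure-frame (esubL _) (λ _ _ → refl) (InternalStep⇒→I p)
InternalStep⇒→I (esubR p) = Closure-frame (esubR _) (λ _ _ → refl) (InternalStep⇒→I p)

infixr 5 _◅⁺_

_◅⁺_ : ∀ {A : Set} {P : A → A → Set} {a b c} → P a b → Star P b c → TransClosure P a c
p ◅⁺ ε        = [ p ]
p ◅⁺ (q ◅ qs) = p ∷ (q ◅⁺ qs)

→F⇒→S⊎→I : ∀ {R a b} → a →F⟨ R ⟩ b → (a →S⟨ R ⟩ b) ⊎ (a →I⟨ R ⟩ b)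
→F⇒→S⊎→I (C , _ , rest) with surface-or-internal C
... | inj₁ s = inj₁ (C , s , rest)
... | inj₂ i = inj₂ (C , i , rest)

→S⊎→I⇒→F : ∀ {R a b} → (a →S⟨ R ⟩ b) ⊎ (a →I⟨ R ⟩ b) → a →F⟨ R ⟩ b
→S⊎→I⇒→F (inj₁ (C , _ , rest)) = C , tt , rest
→S⊎→I⇒→F (inj₂ (C , _ , rest)) = C , tt , rest

→S-terminating : ∀ R → Terminating _→S⟨ R ⟩_
→S-terminating dB = Terminating-by apps
  λ { (C , _ , _ , _ , r , refl , refl) → apps-plug-< C (dB-decreases-apps r) }
→S-terminating s! = Terminating-by (weight (λ _ → 0))
  λ { (C , _ , _ , _ , r , refl , refl) → weight-plug-< C (s!-decreases-weight r) _ }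
→S-terminating d! = Terminating-by (weight (λ _ → 0))
  λ { (C , _ , _ , _ , r , refl , refl) → weight-plug-< C (d!-decreases-weight r) _ }

→I→S-swap : ∀ {R₁ R₂ a c} → (_→I⟨ R₁ ⟩_ ⨾ _→S⟨ R₂ ⟩_) a c →
            (_→S⟨ R₂ ⟩_ ⨾ (Star _→S⟨ R₁ ⟩_ ⨾ Star _→I⟨ R₁ ⟩_)) a c
→I→S-swap (_ , q , p)
  with internal-surface-swap (→I⇒InternalStep q) (→S⇒SurfaceStep p)
... | _ , p′ , _ , ps , qs =
  _ , SurfaceStep⇒→S p′ , _ , gmap id SurfaceStep⇒→S ps , gmap id InternalStep⇒→I qs

lemma7 : SFS _→F_ Rule (λ R t u → t →S⟨ R ⟩ u) (λ R t u → t →I⟨ R ⟩ u)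
lemma7 = record
  { union       = λ a b → (λ (R , step) → R , →F⇒→S⊎→I step)
                        , (λ (R , step) → R , →S⊎→I⇒→F step)
  ; termination = →S-terminating
  ; row-swap    = λ R steps → row (→I→S-swap steps)
  ; diag-swap   = λ R₁ R₂ _ steps → diagonal (→I→S-swap steps)
  }
  where
  row : ∀ {R a c} → (_→S⟨ R ⟩_ ⨾ (Star _→S⟨ R ⟩_ ⨾ Star _→I⟨ R ⟩_)) a c →
        (TransClosure _→S⟨ R ⟩_ ⨾ Star _→I⟨ R ⟩_) a c
  row (_ , p , _ , ps , qs) = _ , p ◅⁺ ps , qs

  diagonal : ∀ {R₁ R₂ a c} → (_→S⟨ R₂ ⟩_ ⨾ (Star _→S⟨ R₁ ⟩_ ⨾ Star _→I⟨ R₁ ⟩_)) a c →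
             (_→S⟨ R₂ ⟩_ ⨾ Star (_→S⟨ R₁ ⟩_ ∪ _→I⟨ R₁ ⟩_)) a c
  diagonal (_ , p , _ , ps , qs) = _ , p , gmap id inj₁ ps ◅◅ gmap id inj₂ qs
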